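{- Let $S$ be a finite set and $\{X_n\}$ a discrete-time Markov chain on $S$ with transition matrix $P$ having a unique stationary distribution $\mu$. Let $\tilde S=\{A_1,\dots,A_m\}$ be a partition of $S$ into nonempty sets and $\alpha_1,\dots,\alpha_m$ probability measures on $S$ with $\alpha_i(s)=0$ for $s\notin A_i$ and $\alpha_i(s)>0$ for $s\in A_i$. Assume (Cond1): for all $i,j$ and all $s,s'\in A_j$, $\delta(A_i,s)=\delta(A_i,s')$, where $\delta(A_i,s)=\frac{\sum_{s'\in A_i}\alpha_i(s')P(s',s)}{\alpha_j(s)}$ for $s\in A_j$. Assume there exists a probability distribution on $S$ which respects $\{\alpha_i\}$. Then $\mu$ respects $\{\alpha_i\}$.
   Context: A distribution $\nu$ on $S$ respects $\{\alpha_i: i=1,\dots,m\}$ if for every $i$ with $\nu(A_i)=\sum_{s\in A_i}\nu(s)>0$, $\nu(s)/\nu(A_i)=\alpha_i(s)$ for all $s\in A_i$. -}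

module Defs where

open import Level using (Level; _⊔_; suc)
open import Algebra.Bundles using (CommutativeRing)
open import Relation.Binary.Structures using (IsTotalOrder)
open import Relation.Nullary using (¬_; yes; no)
open import Relation.Binary.PropositionalEquality using (_≡_)
open import Data.Nat using (ℕ)
open import Data.Fin using (Fin; _≟_)
import Data.Fin
import Relation.Binary.PropositionalEquality
open import Data.Product using (Σ; _×_; ∃; _,_)
import Relation.Nullary

-- Ordered fields (the standard library has neither ℝ nor an ordered-field
-- bundle).  The paper works over ℝ; we state the result for an arbitrary
-- ordered field, of which ℝ is an instance.

record OrderedField (c ℓ₁ ℓ₂ : Level) : Set (suc (c ⊔ ℓ₁ ⊔ ℓ₂)) where
  field
    commutativeRing : CommutativeRing c ℓ₁
  open CommutativeRing commutativeRing public
  infix 4 _≤_ _<_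
  field
    _≤_          : Carrier → Carrier → Set ℓ₂
    isTotalOrder : IsTotalOrder _≈_ _≤_
    +-mono-≤     : ∀ {x y} z → x ≤ y → x + z ≤ y + z
    *-nonneg     : ∀ {x y} → 0# ≤ x → 0# ≤ y → 0# ≤ x * y
    0≉1          : ¬ (0# ≈ 1#)
    inv          : (x : Carrier) → ¬ (x ≈ 0#) → Carrier
    inv-inverse  : ∀ x (p : ¬ (x ≈ 0#)) → x * inv x p ≈ 1#

  _<_ : Carrier → Carrier → Set (ℓ₁ ⊔ ℓ₂)
  x < y = x ≤ y × ¬ (x ≈ y)

  div : (x y : Carrier) → 0# < y → Carrier
  div x y (_ , 0≉y) = x * inv y (λ y≈0 → 0≉y (sym y≈0))

-- Finite Markov chains over an ordered field.  The state space S is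
-- Fin n; the partition {A_1,…,A_m} is given by the block map
-- block : Fin n → Fin m, with A_i = { s | block s ≡ i }.

module Chain {c ℓ₁ ℓ₂} (F : OrderedField c ℓ₁ ℓ₂) where
  open OrderedField F

  Σ[_] : ∀ n → (Fin n → Carrier) → Carrier
  Σ[ ℕ.zero ] f = 0#
  Σ[ ℕ.suc n ] f = f Data.Fin.zero + Σ[ n ] (λ i → f (Data.Fin.suc i))

  Σ-over : ∀ {n m} → (Fin n → Fin m) → Fin m → (Fin n → Carrier) → Carrier
  Σ-over {n} block i f = Σ[ n ] (λ s → indicator (block s ≟ i) (f s))
    where
    indicator : ∀ {a} {A : Set a} → Relation.Nullary.Dec A → Carrier → Carrier
    indicator (yes _) x = x
    indicator (no  _) _ = 0#

  IsDistribution : ∀ n → (Fin n → Carrier) → Set (ℓ₁ ⊔ ℓ₂)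
  IsDistribution n ν = (∀ s → 0# ≤ ν s) × (Σ[ n ] ν ≈ 1#)

  IsStochastic : ∀ n → (Fin n → Fin n → Carrier) → Set (ℓ₁ ⊔ ℓ₂)
  IsStochastic n P = (∀ s t → 0# ≤ P s t) × (∀ s → Σ[ n ] (λ t → P s t) ≈ 1#)

  IsStationary : ∀ n → (Fin n → Fin n → Carrier) → (Fin n → Carrier) → Set (ℓ₁ ⊔ ℓ₂)
  IsStationary n P ν = IsDistribution n ν × (∀ s → Σ[ n ] (λ s' → ν s' * P s' s) ≈ ν s)

  IsUniqueStationary : ∀ n → (Fin n → Fin n → Carrier) → (Fin n → Carrier) → Set (c ⊔ ℓ₁ ⊔ ℓ₂)
  IsUniqueStationary n P μ =
    IsStationary n P μ × (∀ ν → IsStationary n P ν → ∀ s → ν s ≈ μ s)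

  BlocksNonempty : ∀ {n m} → (Fin n → Fin m) → Set
  BlocksNonempty {n} {m} block = ∀ (i : Fin m) → ∃ λ (s : Fin n) → block s ≡ i

  IsAdapted : ∀ {n m} → (Fin n → Fin m) → (Fin m → Fin n → Carrier) → Set (ℓ₁ ⊔ ℓ₂)
  IsAdapted {n} {m} block α =
    (∀ i → IsDistribution n (α i)) ×
    (∀ i s → ¬ (block s ≡ i) → α i s ≈ 0#) ×
    (∀ i s → block s ≡ i → 0# < α i s)

  δ : ∀ {n m} (P : Fin n → Fin n → Carrier) (block : Fin n → Fin m)
      (α : Fin m → Fin n → Carrier) →
      (∀ s → 0# < α (block s) s) → Fin m → Fin n → Carrier
  δ P block α pos i s =
    div (Σ-over block i (λ s' → α i s' * P s' s)) (α (block s) s) (pos s)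

  Cond1 : ∀ {n m} (P : Fin n → Fin n → Carrier) (block : Fin n → Fin m)
          (α : Fin m → Fin n → Carrier) → (∀ s → 0# < α (block s) s) → Set ℓ₁
  Cond1 P block α pos =
    ∀ i s s' → block s ≡ block s' → δ P block α pos i s ≈ δ P block α pos i s'

  Respects : ∀ {n m} → (Fin n → Fin m) → (Fin m → Fin n → Carrier) →
             (Fin n → Carrier) → Set (ℓ₁ ⊔ ℓ₂)
  Respects block α ν =
    ∀ i (p : 0# < Σ-over block i ν) → ∀ s → block s ≡ i →
      div (ν s) (Σ-over block i ν) p ≈ α i s

  Cond1′ : ∀ {n m} (P : Fin n → Fin n → Carrier) (block : Fin n → Fin m)
           (α : Fin m → Fin n → Carrier) → IsAdapted block α → Set ℓ₁
  Cond1′ P block α (_ , _ , pos) = Cond1 P block α (λ s → pos (block s) s Relation.Binary.PropositionalEquality.refl)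

-- Cond1 makes the span of the α_j invariant under P: α_i P = Σ_j Q i j α_j, where Q is the
-- stochastic matrix of the chain lumped onto the blocks.  Hence the lift u ↦ Σ_j u_j α_j sends
-- stationary distributions of Q to stationary distributions of P, and it is injective (block
-- sums recover u), so Q inherits uniqueness from P.  A stochastic matrix with at most one
-- stationary distribution has one: censor the state p least likely to stay put, solve the
-- censored chain by induction, and reinsert at p its inflow divided by its exit probability.
-- That exit probability cannot be 0, for then every state would be absorbing and the point
-- masses would be distinct stationary distributions; uniqueness is what replaces the case split
-- on "exit probability = 0", which is undecidable over an ordered field.  So μ is a lift, and
-- lifts respect the α_i.

module Submission where

open import Level using (_⊔_)
open import Defs
open import Data.Nat using (ℕ; zero; suc)
open import Data.Fin using (Fin; zero; suc; _≟_; punchIn; punchOut)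
open import Data.Fin.Properties using (punchInᵢ≢i; punchIn-punchOut)
open import Data.Product using (Σ; _×_; _,_; proj₁; proj₂; ∃)
open import Data.Sum using (inj₁; inj₂)
open import Data.Empty using (⊥-elim)
open import Function using (_∘_)
open import Data.Vec.Functional using (insertAt)
open import Data.Vec.Functional.Properties using (insertAt-lookup; insertAt-punchIn)
open import Relation.Nullary using (¬_; Dec; yes; no)
open import Relation.Binary.PropositionalEquality as ≡ using (_≡_; _≢_)
open import Relation.Binary.Structures using (IsTotalOrder)
open import Relation.Binary.Bundles using (TotalOrder)
open import Data.List using (allFin)
open import Data.List.Relation.Unary.All using (lookup)
open import Data.List.Membership.Propositional.Properties using (∈-allFin)
import Data.List.Extrema as Extrema
import Algebra.Properties.CommutativeSemigroup as CommutativeSemigroupProperties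
import Algebra.Properties.Ring as RingProperties
import Algebra.Properties.Semiring.Sum as SemiringSum
import Relation.Binary.Reasoning.Setoid as SetoidReasoning

punchIn-cases : ∀ {a n} (Pr : Fin (suc n) → Set a) p →
                Pr p → (∀ j → Pr (punchIn p j)) → ∀ x → Pr x
punchIn-cases Pr p Pr-p Pr-punchIn x with p ≟ x
... | yes ≡.refl = Pr-p
... | no p≢x = ≡.subst Pr (punchIn-punchOut p≢x) (Pr-punchIn (punchOut p≢x))

module OrderedFieldProperties {c ℓ₁ ℓ₂} (F : OrderedField c ℓ₁ ℓ₂) where
  open OrderedField F hiding (zero)
  open RingProperties ring using (-1*x≈-x; -‿involutive; -‿distribʳ-*)
  open IsTotalOrder isTotalOrder public
    using (total; antisym)
    renaming (refl to ≤-refl; trans to ≤-trans; ≲-respˡ-≈ to ≤-respˡ-≈; ≲-respʳ-≈ to ≤-respʳ-≈)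

  totalOrder : TotalOrder c ℓ₁ ℓ₂
  totalOrder = record { isTotalOrder = isTotalOrder }

  x≤0⇒0≤-x : ∀ {x} → x ≤ 0# → 0# ≤ - x
  x≤0⇒0≤-x {x} x≤0 = ≤-respˡ-≈ (-‿inverseʳ x) (≤-respʳ-≈ (+-identityˡ (- x)) (+-mono-≤ (- x) x≤0))

  0≤-x⇒x≤0 : ∀ {x} → 0# ≤ - x → x ≤ 0#
  0≤-x⇒x≤0 {x} 0≤-x = ≤-respˡ-≈ (+-identityˡ x) (≤-respʳ-≈ (-‿inverseˡ x) (+-mono-≤ x 0≤-x))

  1≰0 : ¬ 1# ≤ 0#
  1≰0 1≤0 = 0≉1 (antisym (≤-respʳ-≈ -1*-1≈1 (*-nonneg 0≤-1 0≤-1)) 1≤0)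
    where
    0≤-1 : 0# ≤ - 1#
    0≤-1 = x≤0⇒0≤-x 1≤0
    -1*-1≈1 : - 1# * - 1# ≈ 1#
    -1*-1≈1 = trans (-1*x≈-x (- 1#)) (-‿involutive 1#)

  0≤1 : 0# ≤ 1#
  0≤1 with total 0# 1#
  ... | inj₁ 0≤1 = 0≤1
  ... | inj₂ 1≤0 = ⊥-elim (1≰0 1≤0)

  +-nonneg : ∀ {x y} → 0# ≤ x → 0# ≤ y → 0# ≤ x + y
  +-nonneg {x} {y} 0≤x 0≤y = ≤-trans 0≤y (≤-respˡ-≈ (+-identityˡ y) (+-mono-≤ y 0≤x))

  x≤y+x : ∀ {x y} → 0# ≤ y → x ≤ y + x
  x≤y+x {x} 0≤y = ≤-respˡ-≈ (+-identityˡ x) (+-mono-≤ x 0≤y)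

  x≤x+y : ∀ {x y} → 0# ≤ y → x ≤ x + y
  x≤x+y {x} {y} 0≤y = ≤-respʳ-≈ (+-comm y x) (x≤y+x 0≤y)

  x+1≉0 : ∀ {x} → 0# ≤ x → ¬ x + 1# ≈ 0#
  x+1≉0 0≤x x+1≈0 = 1≰0 (≤-respʳ-≈ x+1≈0 (x≤y+x 0≤x))

  inverse-nonneg : ∀ {x y} → 0# ≤ x → x * y ≈ 1# → 0# ≤ y
  inverse-nonneg {x} {y} 0≤x xy≈1 with total 0# y
  ... | inj₁ 0≤y = 0≤y
  ... | inj₂ y≤0 = ⊥-elim (1≰0 (0≤-x⇒x≤0 (≤-respʳ-≈ x*-y≈-1 (*-nonneg 0≤x (x≤0⇒0≤-x y≤0)))))
    where
    x*-y≈-1 : x * - y ≈ - 1#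
    x*-y≈-1 = trans (sym (-‿distribʳ-* x y)) (-‿cong xy≈1)

  inverse-nonzero : ∀ {x y} → x * y ≈ 1# → ¬ y ≈ 0#
  inverse-nonzero {x} xy≈1 y≈0 = 0≉1 (trans (sym (zeroʳ x)) (trans (*-congˡ (sym y≈0)) xy≈1))

  *-cancelʳ : ∀ {x y z} → ¬ z ≈ 0# → x * z ≈ y * z → x ≈ y
  *-cancelʳ {x} {y} {z} z≉0 xz≈yz = begin
    x                ≈⟨ *-identityʳ x ⟨
    x * 1#           ≈⟨ *-congˡ (inv-inverse z z≉0) ⟨
    x * (z * z⁻¹)    ≈⟨ *-assoc x z z⁻¹ ⟨
    x * z * z⁻¹      ≈⟨ *-congʳ xz≈yz ⟩
    y * z * z⁻¹      ≈⟨ *-assoc y z z⁻¹ ⟩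
    y * (z * z⁻¹)    ≈⟨ *-congˡ (inv-inverse z z≉0) ⟩
    y * 1#           ≈⟨ *-identityʳ y ⟩
    y                ∎
    where
    open SetoidReasoning setoid
    z⁻¹ = inv z z≉0

  div-*-inverse : ∀ x y (0<y : 0# < y) → div x y 0<y * y ≈ x
  div-*-inverse x y (_ , 0≉y) = begin
    x * y⁻¹ * y    ≈⟨ *-assoc x y⁻¹ y ⟩
    x * (y⁻¹ * y)  ≈⟨ *-congˡ (*-comm y⁻¹ y) ⟩
    x * (y * y⁻¹)  ≈⟨ *-congˡ (inv-inverse y _) ⟩
    x * 1#         ≈⟨ *-identityʳ x ⟩
    x              ∎
    where
    open SetoidReasoning setoid
    y⁻¹ = inv y (λ y≈0 → 0≉y (sym y≈0))

  div-unique : ∀ {x y a} (0<y : 0# < y) → x ≈ y * a → div x y 0<y ≈ a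
  div-unique {x} {y} {a} 0<y@(_ , 0≉y) x≈ya = *-cancelʳ y≉0 (begin
    div x y 0<y * y  ≈⟨ div-*-inverse x y 0<y ⟩
    x                ≈⟨ x≈ya ⟩
    y * a            ≈⟨ *-comm y a ⟩
    a * y            ∎)
    where
    open SetoidReasoning setoid
    y≉0 : ¬ y ≈ 0#
    y≉0 y≈0 = 0≉y (sym y≈0)

module Sums {c ℓ₁ ℓ₂} (F : OrderedField c ℓ₁ ℓ₂) where
  open OrderedField F hiding (zero)
  open Chain F
  open OrderedFieldProperties F
  open SemiringSum semiring
    using (sum; sum-cong-≋; sum-replicate-zero; sum-remove; ∑-distrib-+; ∑-comm; *-distribˡ-sum; *-distribʳ-sum)
  open SetoidReasoning setoid

  Σ≡sum : ∀ n (f : Fin n → Carrier) → Σ[ n ] f ≡ sum f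
  Σ≡sum zero    f = ≡.refl
  Σ≡sum (suc n) f = ≡.cong (f zero +_) (Σ≡sum n (f ∘ suc))

  Σ-cong : ∀ n {f g : Fin n → Carrier} → (∀ i → f i ≈ g i) → Σ[ n ] f ≈ Σ[ n ] g
  Σ-cong n {f} {g} f≈g rewrite Σ≡sum n f | Σ≡sum n g = sum-cong-≋ f≈g

  Σ-zero : ∀ n {f : Fin n → Carrier} → (∀ i → f i ≈ 0#) → Σ[ n ] f ≈ 0#
  Σ-zero n f≈0 = trans (Σ-cong n f≈0) (trans (reflexive (Σ≡sum n (λ _ → 0#))) (sum-replicate-zero n))

  Σ-distrib-+ : ∀ n (f g : Fin n → Carrier) → Σ[ n ] (λ i → f i + g i) ≈ Σ[ n ] f + Σ[ n ] g
  Σ-distrib-+ n f g rewrite Σ≡sum n (λ i → f i + g i) | Σ≡sum n f | Σ≡sum n g = ∑-distrib-+ f g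

  *-distribˡ-Σ : ∀ n x (f : Fin n → Carrier) → x * Σ[ n ] f ≈ Σ[ n ] (λ i → x * f i)
  *-distribˡ-Σ n x f rewrite Σ≡sum n f | Σ≡sum n (λ i → x * f i) = *-distribˡ-sum x f

  *-distribʳ-Σ : ∀ n x (f : Fin n → Carrier) → Σ[ n ] f * x ≈ Σ[ n ] (λ i → f i * x)
  *-distribʳ-Σ n x f rewrite Σ≡sum n f | Σ≡sum n (λ i → f i * x) = *-distribʳ-sum x f

  Σ-comm : ∀ n m (f : Fin n → Fin m → Carrier) →
           Σ[ n ] (λ i → Σ[ m ] (f i)) ≈ Σ[ m ] (λ j → Σ[ n ] (λ i → f i j))
  Σ-comm n m f rewrite Σ≡sum n (λ i → Σ[ m ] (f i)) | Σ≡sum m (λ j → Σ[ n ] (λ i → f i j)) = begin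
    sum (λ i → Σ[ m ] (f i))            ≈⟨ sum-cong-≋ (λ i → reflexive (Σ≡sum m (f i))) ⟩
    sum (λ i → sum (f i))               ≈⟨ ∑-comm f ⟩
    sum (λ j → sum (λ i → f i j))       ≈⟨ sum-cong-≋ (λ j → reflexive (≡.sym (Σ≡sum n (λ i → f i j)))) ⟩
    sum (λ j → Σ[ n ] (λ i → f i j))    ∎

  Σ-remove : ∀ n (f : Fin (suc n) → Carrier) i → Σ[ suc n ] f ≈ f i + Σ[ n ] (f ∘ punchIn i)
  Σ-remove n f i rewrite Σ≡sum (suc n) f | Σ≡sum n (f ∘ punchIn i) = sum-remove f

  Σ-nonneg : ∀ n {f : Fin n → Carrier} → (∀ i → 0# ≤ f i) → 0# ≤ Σ[ n ] f
  Σ-nonneg zero    0≤f = ≤-refl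
  Σ-nonneg (suc n) 0≤f = +-nonneg (0≤f zero) (Σ-nonneg n (0≤f ∘ suc))

  term≤Σ : ∀ n {f : Fin (suc n) → Carrier} → (∀ i → 0# ≤ f i) → ∀ i → f i ≤ Σ[ suc n ] f
  term≤Σ n {f} 0≤f i = ≤-respʳ-≈ (sym (Σ-remove n f i)) (x≤x+y (Σ-nonneg n (0≤f ∘ punchIn i)))

  nonneg-Σ≈0 : ∀ n {f : Fin n → Carrier} → (∀ i → 0# ≤ f i) → Σ[ n ] f ≈ 0# → ∀ i → f i ≈ 0#
  nonneg-Σ≈0 (suc n) 0≤f Σ≈0 i = antisym (≤-respʳ-≈ Σ≈0 (term≤Σ n 0≤f i)) (0≤f i)

  Σ-insertAt-* : ∀ n (u : Fin n → Carrier) p a (g : Fin (suc n) → Carrier) →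
                 Σ[ suc n ] (λ y → insertAt u p a y * g y) ≈ a * g p + Σ[ n ] (λ j → u j * g (punchIn p j))
  Σ-insertAt-* n u p a g = begin
    Σ[ suc n ] (λ y → insertAt u p a y * g y)
      ≈⟨ Σ-remove n (λ y → insertAt u p a y * g y) p ⟩
    insertAt u p a p * g p + Σ[ n ] (λ j → insertAt u p a (punchIn p j) * g (punchIn p j))
      ≈⟨ +-cong (*-congʳ (reflexive (insertAt-lookup u p a)))
                (Σ-cong n (λ j → *-congʳ (reflexive (insertAt-punchIn u p a j)))) ⟩
    a * g p + Σ[ n ] (λ j → u j * g (punchIn p j))
      ∎

  when : ∀ {a} {A : Set a} → Dec A → Carrier → Carrier
  when (yes _) x = x
  when (no _)  _ = 0#

  module _ {a} {A : Set a} where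

    when-yes : ∀ (d : Dec A) {x} → A → when d x ≈ x
    when-yes (yes _) _ = refl
    when-yes (no ¬a) a = ⊥-elim (¬a a)

    when-no : ∀ (d : Dec A) {x} → ¬ A → when d x ≈ 0#
    when-no (yes a) ¬a = ⊥-elim (¬a a)
    when-no (no _)  _  = refl

    when-cong : ∀ (d : Dec A) {x y} → (A → x ≈ y) → when d x ≈ when d y
    when-cong (yes a) x≈y = x≈y a
    when-cong (no _)  _   = refl

    when-nonneg : ∀ (d : Dec A) {x} → 0# ≤ x → 0# ≤ when d x
    when-nonneg (yes _) 0≤x = 0≤x
    when-nonneg (no _)  _   = ≤-refl

    *-distribˡ-when : ∀ (d : Dec A) x y → x * when d y ≈ when d (x * y)
    *-distribˡ-when (yes _) x y = refl
    *-distribˡ-when (no _)  x y = zeroʳ x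

    Σ-when : ∀ (d : Dec A) n (f : Fin n → Carrier) → Σ[ n ] (λ i → when d (f i)) ≈ when d (Σ[ n ] f)
    Σ-when (yes _) n f = refl
    Σ-when (no _)  n f = Σ-zero n (λ _ → refl)

  Σ-when-≟ : ∀ {n} (x : Fin n) (g : Fin n → Carrier) → Σ[ n ] (λ y → when (x ≟ y) (g y)) ≈ g x
  Σ-when-≟ {suc n} x g = begin
    Σ[ suc n ] (λ y → when (x ≟ y) (g y))
      ≈⟨ Σ-remove n (λ y → when (x ≟ y) (g y)) x ⟩
    when (x ≟ x) (g x) + Σ[ n ] (λ j → when (x ≟ punchIn x j) (g (punchIn x j)))
      ≈⟨ +-cong (when-yes (x ≟ x) ≡.refl) (Σ-zero n (λ j → when-no (x ≟ punchIn x j) (punchInᵢ≢i x j ∘ ≡.sym))) ⟩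
    g x + 0#
      ≈⟨ +-identityʳ (g x) ⟩
    g x
      ∎

  module _ {n m} (b : Fin n → Fin m) where

    Σ-over≈Σ-when : ∀ i f → Σ-over b i f ≈ Σ[ n ] (λ s → when (b s ≟ i) (f s))
    Σ-over≈Σ-when i f = go b f
      where
      go : ∀ {n} (b : Fin n → Fin m) f → Σ-over b i f ≈ Σ[ n ] (λ s → when (b s ≟ i) (f s))
      go {zero}  b f = refl
      go {suc n} b f with b zero ≟ i
      ... | yes _ = +-congˡ (go (b ∘ suc) (f ∘ suc))
      ... | no _  = +-congˡ (go (b ∘ suc) (f ∘ suc))

    Σ-over-cong : ∀ i {f g} → (∀ s → b s ≡ i → f s ≈ g s) → Σ-over b i f ≈ Σ-over b i g
    Σ-over-cong i {f} {g} f≈g = begin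
      Σ-over b i f                            ≈⟨ Σ-over≈Σ-when i f ⟩
      Σ[ n ] (λ s → when (b s ≟ i) (f s))     ≈⟨ Σ-cong n (λ s → when-cong (b s ≟ i) (f≈g s)) ⟩
      Σ[ n ] (λ s → when (b s ≟ i) (g s))     ≈⟨ Σ-over≈Σ-when i g ⟨
      Σ-over b i g                            ∎

    Σ-over-nonneg : ∀ i {f} → (∀ s → 0# ≤ f s) → 0# ≤ Σ-over b i f
    Σ-over-nonneg i {f} 0≤f =
      ≤-respʳ-≈ (sym (Σ-over≈Σ-when i f)) (Σ-nonneg n (λ s → when-nonneg (b s ≟ i) (0≤f s)))

    *-distribˡ-Σ-over : ∀ i x f → x * Σ-over b i f ≈ Σ-over b i (λ s → x * f s)
    *-distribˡ-Σ-over i x f = begin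
      x * Σ-over b i f                               ≈⟨ *-congˡ (Σ-over≈Σ-when i f) ⟩
      x * Σ[ n ] (λ s → when (b s ≟ i) (f s))        ≈⟨ *-distribˡ-Σ n x _ ⟩
      Σ[ n ] (λ s → x * when (b s ≟ i) (f s))        ≈⟨ Σ-cong n (λ s → *-distribˡ-when (b s ≟ i) x (f s)) ⟩
      Σ[ n ] (λ s → when (b s ≟ i) (x * f s))        ≈⟨ Σ-over≈Σ-when i _ ⟨
      Σ-over b i (λ s → x * f s)                     ∎

    Σ-over-supported : ∀ i {f} → (∀ s → b s ≢ i → f s ≈ 0#) → Σ-over b i f ≈ Σ[ n ] f
    Σ-over-supported i {f} f≈0 = trans (Σ-over≈Σ-when i f) (Σ-cong n when≈id)
      where
      when≈id : ∀ s → when (b s ≟ i) (f s) ≈ f s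
      when≈id s with b s ≟ i
      ... | yes _   = refl
      ... | no bs≢i = sym (f≈0 s bs≢i)

    Σ-Σ-over-comm : ∀ i {k} (g : Fin n → Fin k → Carrier) →
                    Σ[ k ] (λ t → Σ-over b i (λ s → g s t)) ≈ Σ-over b i (λ s → Σ[ k ] (g s))
    Σ-Σ-over-comm i {k} g = begin
      Σ[ k ] (λ t → Σ-over b i (λ s → g s t))                 ≈⟨ Σ-cong k (λ t → Σ-over≈Σ-when i _) ⟩
      Σ[ k ] (λ t → Σ[ n ] (λ s → when (b s ≟ i) (g s t)))    ≈⟨ Σ-comm k n _ ⟩
      Σ[ n ] (λ s → Σ[ k ] (λ t → when (b s ≟ i) (g s t)))    ≈⟨ Σ-cong n (λ s → Σ-when (b s ≟ i) k (g s)) ⟩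
      Σ[ n ] (λ s → when (b s ≟ i) (Σ[ k ] (g s)))            ≈⟨ Σ-over≈Σ-when i _ ⟨
      Σ-over b i (λ s → Σ[ k ] (g s))                         ∎

    Σ-partition : ∀ f → Σ[ n ] f ≈ Σ[ m ] (λ j → Σ-over b j f)
    Σ-partition f = begin
      Σ[ n ] f                                                ≈⟨ Σ-cong n (λ s → Σ-when-≟ (b s) (λ _ → f s)) ⟨
      Σ[ n ] (λ s → Σ[ m ] (λ j → when (b s ≟ j) (f s)))      ≈⟨ Σ-comm n m _ ⟩
      Σ[ m ] (λ j → Σ[ n ] (λ s → when (b s ≟ j) (f s)))      ≈⟨ Σ-cong m (λ j → Σ-over≈Σ-when j f) ⟨
      Σ[ m ] (λ j → Σ-over b j f)                             ∎

module Stationarity {c ℓ₁ ℓ₂} (F : OrderedField c ℓ₁ ℓ₂) where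
  open OrderedField F hiding (zero)
  open Chain F
  open OrderedFieldProperties F
  open Sums F
  open RingProperties ring using (+-identityʳ-unique)
  open CommutativeSemigroupProperties *-commutativeSemigroup using (xy∙z≈xz∙y; x∙yz≈zx∙y)
  open Extrema totalOrder using (argmin; f[argmin]≤f[xs])
  open SetoidReasoning setoid

  IsInvariant : ∀ n → (Fin n → Fin n → Carrier) → (Fin n → Carrier) → Set ℓ₁
  IsInvariant n Q w = ∀ x → Σ[ n ] (λ y → w y * Q y x) ≈ w x

  AtMostOneStationary : ∀ n → (Fin n → Fin n → Carrier) → Set (c ⊔ ℓ₁ ⊔ ℓ₂)
  AtMostOneStationary n Q = ∀ u v → IsStationary n Q u → IsStationary n Q v → ∀ x → u x ≈ v x

  pointMass : ∀ {n} → Fin n → Fin n → Carrier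
  pointMass x y = when (x ≟ y) 1#

  pointMass-stationary : ∀ {n} (Q : Fin n → Fin n → Carrier) x →
                         (∀ y → Q x y ≈ pointMass x y) → IsStationary n Q (pointMass x)
  pointMass-stationary {n} Q x row-x =
    ((λ y → when-nonneg (x ≟ y) 0≤1) , Σ-when-≟ x (λ _ → 1#)) , invariant
    where
    invariant : IsInvariant n Q (pointMass x)
    invariant z = begin
      Σ[ n ] (λ y → when (x ≟ y) 1# * Q y z)   ≈⟨ Σ-cong n (λ y → trans (*-comm _ _) (*-distribˡ-when (x ≟ y) (Q y z) 1#)) ⟩
      Σ[ n ] (λ y → when (x ≟ y) (Q y z * 1#)) ≈⟨ Σ-when-≟ x (λ y → Q y z * 1#) ⟩
      Q x z * 1#                              ≈⟨ *-identityʳ (Q x z) ⟩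
      Q x z                                   ≈⟨ row-x z ⟩
      pointMass x z                           ∎

  row-pointMass : ∀ {K} {Q : Fin (suc K) → Fin (suc K) → Carrier} → IsStochastic (suc K) Q →
                  ∀ x → Q x x ≈ 1# → ∀ y → Q x y ≈ pointMass x y
  row-pointMass {K} {Q} (Q-nonneg , Q-rows) x Qxx≈1 = punchIn-cases _ x on-diagonal off-diagonal
    where
    leaving≈0 : Σ[ K ] (λ j → Q x (punchIn x j)) ≈ 0#
    leaving≈0 = +-identityʳ-unique 1# _ (begin
      1# + Σ[ K ] (λ j → Q x (punchIn x j))     ≈⟨ +-congʳ Qxx≈1 ⟨
      Q x x + Σ[ K ] (λ j → Q x (punchIn x j))  ≈⟨ Σ-remove K (Q x) x ⟨
      Σ[ suc K ] (Q x)                          ≈⟨ Q-rows x ⟩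
      1#                                        ∎)
    on-diagonal : Q x x ≈ pointMass x x
    on-diagonal = trans Qxx≈1 (sym (when-yes (x ≟ x) ≡.refl))
    off-diagonal : ∀ j → Q x (punchIn x j) ≈ pointMass x (punchIn x j)
    off-diagonal j = trans (nonneg-Σ≈0 K (λ j → Q-nonneg x (punchIn x j)) leaving≈0 j)
                           (sym (when-no (x ≟ punchIn x j) (punchInᵢ≢i x j ∘ ≡.sym)))

  normalised-stationary : ∀ {n Q w Z} → (∀ x → 0# ≤ w x) → IsInvariant n Q w →
                          Σ[ n ] w ≈ Z → (Z≉0 : ¬ Z ≈ 0#) →
                          IsStationary n Q (λ x → w x * inv Z Z≉0)
  normalised-stationary {n} {Q} {w} {Z} 0≤w w-invariant Σw≈Z Z≉0 =
    ((λ x → *-nonneg (0≤w x) 0≤Z⁻¹) , sums-to-1) , invariant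
    where
    Z⁻¹ = inv Z Z≉0
    0≤Z⁻¹ : 0# ≤ Z⁻¹
    0≤Z⁻¹ = inverse-nonneg (≤-respʳ-≈ Σw≈Z (Σ-nonneg n 0≤w)) (inv-inverse Z Z≉0)
    sums-to-1 : Σ[ n ] (λ x → w x * Z⁻¹) ≈ 1#
    sums-to-1 = begin
      Σ[ n ] (λ x → w x * Z⁻¹)  ≈⟨ *-distribʳ-Σ n Z⁻¹ w ⟨
      Σ[ n ] w * Z⁻¹            ≈⟨ *-congʳ Σw≈Z ⟩
      Z * Z⁻¹                   ≈⟨ inv-inverse Z Z≉0 ⟩
      1#                        ∎
    invariant : IsInvariant n Q (λ x → w x * Z⁻¹)
    invariant x = begin
      Σ[ n ] (λ y → w y * Z⁻¹ * Q y x)  ≈⟨ Σ-cong n (λ y → xy∙z≈xz∙y (w y) Z⁻¹ (Q y x)) ⟩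
      Σ[ n ] (λ y → w y * Q y x * Z⁻¹)  ≈⟨ *-distribʳ-Σ n Z⁻¹ (λ y → w y * Q y x) ⟨
      Σ[ n ] (λ y → w y * Q y x) * Z⁻¹  ≈⟨ *-congʳ (w-invariant x) ⟩
      w x * Z⁻¹                         ∎

  proportional-distributions-equal : ∀ {n} {u v : Fin n → Carrier} {a b} →
      Σ[ n ] u ≈ 1# → Σ[ n ] v ≈ 1# → ¬ a ≈ 0# → (∀ j → u j * a ≈ v j * b) → ∀ j → u j ≈ v j
  proportional-distributions-equal {n} {u} {v} {a} {b} Σu≈1 Σv≈1 a≉0 ua≈vb j =
    *-cancelʳ a≉0 (trans (ua≈vb j) (*-congˡ (sym a≈b)))
    where
    a≈b : a ≈ b
    a≈b = begin
      a                          ≈⟨ *-identityˡ a ⟨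
      1# * a                     ≈⟨ *-congʳ Σu≈1 ⟨
      Σ[ n ] u * a               ≈⟨ *-distribʳ-Σ n a u ⟩
      Σ[ n ] (λ j → u j * a)     ≈⟨ Σ-cong n ua≈vb ⟩
      Σ[ n ] (λ j → v j * b)     ≈⟨ *-distribʳ-Σ n b v ⟨
      Σ[ n ] v * b               ≈⟨ *-congʳ Σv≈1 ⟩
      1# * b                     ≈⟨ *-identityˡ b ⟩
      b                          ∎

  diagonal-minimum : ∀ {n} (Q : Fin (suc n) → Fin (suc n) → Carrier) → ∃ λ p → ∀ x → Q p p ≤ Q x x
  diagonal-minimum {n} Q =
    argmin diagonal zero (allFin (suc n)) ,
    λ x → lookup (f[argmin]≤f[xs] {f = diagonal} zero (allFin (suc n))) (∈-allFin x)
    where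
    diagonal : Fin (suc n) → Carrier
    diagonal x = Q x x

  exitProb : ∀ {K} → (Fin (suc K) → Fin (suc K) → Carrier) → Fin (suc K) → Carrier
  exitProb {K} Q p = Σ[ K ] (λ j → Q p (punchIn p j))

  stay+exit≈1 : ∀ {K} {Q : Fin (suc K) → Fin (suc K) → Carrier} → IsStochastic (suc K) Q →
                ∀ p → Q p p + exitProb Q p ≈ 1#
  stay+exit≈1 {K} {Q} (_ , Q-rows) p = trans (sym (Σ-remove K (Q p) p)) (Q-rows p)

  module Censoring {K} (Q : Fin (suc K) → Fin (suc K) → Carrier) (Q-stochastic : IsStochastic (suc K) Q)
                   (p : Fin (suc K)) (t : Carrier) (exit*t≈1 : exitProb Q p * t ≈ 1#) where

    private
      ι : Fin K → Fin (suc K)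
      ι = punchIn p
      Q-nonneg = proj₁ Q-stochastic
      Q-rows   = proj₂ Q-stochastic

    0≤t : 0# ≤ t
    0≤t = inverse-nonneg (Σ-nonneg K (λ j → Q-nonneg p (ι j))) exit*t≈1

    -- An excursion through p re-enters at ι j with probability Q p (ι j) / exitProb Q p.
    censored : Fin K → Fin K → Carrier
    censored i j = Q (ι i) (ι j) + Q (ι i) p * (Q p (ι j) * t)

    Σ-reentry : ∀ a → Σ[ K ] (λ j → a * (Q p (ι j) * t)) ≈ a
    Σ-reentry a = begin
      Σ[ K ] (λ j → a * (Q p (ι j) * t))  ≈⟨ *-distribˡ-Σ K a _ ⟨
      a * Σ[ K ] (λ j → Q p (ι j) * t)    ≈⟨ *-congˡ (*-distribʳ-Σ K t (λ j → Q p (ι j))) ⟨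
      a * (exitProb Q p * t)              ≈⟨ *-congˡ exit*t≈1 ⟩
      a * 1#                              ≈⟨ *-identityʳ a ⟩
      a                                   ∎

    censored-stochastic : IsStochastic K censored
    censored-stochastic = censored-nonneg , censored-rows
      where
      censored-nonneg : ∀ i j → 0# ≤ censored i j
      censored-nonneg i j =
        +-nonneg (Q-nonneg _ _) (*-nonneg (Q-nonneg _ _) (*-nonneg (Q-nonneg _ _) 0≤t))
      censored-rows : ∀ i → Σ[ K ] (censored i) ≈ 1#
      censored-rows i = begin
        Σ[ K ] (censored i)
          ≈⟨ Σ-distrib-+ K _ _ ⟩
        Σ[ K ] (λ j → Q (ι i) (ι j)) + Σ[ K ] (λ j → Q (ι i) p * (Q p (ι j) * t))
          ≈⟨ +-congˡ (Σ-reentry (Q (ι i) p)) ⟩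
        Σ[ K ] (λ j → Q (ι i) (ι j)) + Q (ι i) p
          ≈⟨ +-comm _ _ ⟩
        Q (ι i) p + Σ[ K ] (λ j → Q (ι i) (ι j))
          ≈⟨ Σ-remove K (Q (ι i)) p ⟨
        Σ[ suc K ] (Q (ι i))
          ≈⟨ Q-rows (ι i) ⟩
        1#
          ∎

    returnMass : (Fin K → Carrier) → Carrier
    returnMass u = Σ[ K ] (λ i → u i * Q (ι i) p)

    -- The mass at p is its inflow times the expected length 1/exitProb of a stay at p.
    uncensor : (Fin K → Carrier) → Fin (suc K) → Carrier
    uncensor u = insertAt u p (t * returnMass u)

    uncensor-nonneg : ∀ u → (∀ i → 0# ≤ u i) → ∀ x → 0# ≤ uncensor u x
    uncensor-nonneg u 0≤u = punchIn-cases _ p at-p at-ι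
      where
      at-p : 0# ≤ uncensor u p
      at-p = ≤-respʳ-≈ (reflexive (≡.sym (insertAt-lookup u p _)))
                       (*-nonneg 0≤t (Σ-nonneg K (λ i → *-nonneg (0≤u i) (Q-nonneg _ _))))
      at-ι : ∀ j → 0# ≤ uncensor u (ι j)
      at-ι j = ≤-respʳ-≈ (reflexive (≡.sym (insertAt-punchIn u p _ j))) (0≤u j)

    uncensor-invariant : ∀ u → IsInvariant K censored u → IsInvariant (suc K) Q (uncensor u)
    uncensor-invariant u u-invariant = punchIn-cases _ p at-p at-ι
      where
      wₚ = t * returnMass u
      returnMass≈wₚ*exit : returnMass u ≈ wₚ * exitProb Q p
      returnMass≈wₚ*exit = begin
        returnMass u                        ≈⟨ *-identityʳ _ ⟨
        returnMass u * 1#                   ≈⟨ *-congˡ exit*t≈1 ⟨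
        returnMass u * (exitProb Q p * t)   ≈⟨ x∙yz≈zx∙y _ _ _ ⟩
        wₚ * exitProb Q p                   ∎
      at-p : Σ[ suc K ] (λ y → uncensor u y * Q y p) ≈ uncensor u p
      at-p = begin
        Σ[ suc K ] (λ y → uncensor u y * Q y p)  ≈⟨ Σ-insertAt-* K u p wₚ (λ y → Q y p) ⟩
        wₚ * Q p p + returnMass u                ≈⟨ +-congˡ returnMass≈wₚ*exit ⟩
        wₚ * Q p p + wₚ * exitProb Q p           ≈⟨ distribˡ wₚ _ _ ⟨
        wₚ * (Q p p + exitProb Q p)              ≈⟨ *-congˡ (stay+exit≈1 Q-stochastic p) ⟩
        wₚ * 1#                                  ≈⟨ *-identityʳ wₚ ⟩
        wₚ                                       ≡⟨ insertAt-lookup u p wₚ ⟨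
        uncensor u p                             ∎
      Σ-censored : ∀ j → Σ[ K ] (λ i → u i * censored i j) ≈
                         Σ[ K ] (λ i → u i * Q (ι i) (ι j)) + wₚ * Q p (ι j)
      Σ-censored j = begin
        Σ[ K ] (λ i → u i * censored i j)
          ≈⟨ Σ-cong K (λ i → distribˡ (u i) _ _) ⟩
        Σ[ K ] (λ i → u i * Q (ι i) (ι j) + u i * (Q (ι i) p * (Q p (ι j) * t)))
          ≈⟨ Σ-distrib-+ K _ _ ⟩
        Σ[ K ] (λ i → u i * Q (ι i) (ι j)) + Σ[ K ] (λ i → u i * (Q (ι i) p * (Q p (ι j) * t)))
          ≈⟨ +-congˡ (Σ-cong K (λ i → *-assoc (u i) _ _)) ⟨
        Σ[ K ] (λ i → u i * Q (ι i) (ι j)) + Σ[ K ] (λ i → u i * Q (ι i) p * (Q p (ι j) * t))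
          ≈⟨ +-congˡ (*-distribʳ-Σ K _ _) ⟨
        Σ[ K ] (λ i → u i * Q (ι i) (ι j)) + returnMass u * (Q p (ι j) * t)
          ≈⟨ +-congˡ (x∙yz≈zx∙y _ _ _) ⟩
        Σ[ K ] (λ i → u i * Q (ι i) (ι j)) + wₚ * Q p (ι j)
          ∎
      at-ι : ∀ j → Σ[ suc K ] (λ y → uncensor u y * Q y (ι j)) ≈ uncensor u (ι j)
      at-ι j = begin
        Σ[ suc K ] (λ y → uncensor u y * Q y (ι j))         ≈⟨ Σ-insertAt-* K u p wₚ (λ y → Q y (ι j)) ⟩
        wₚ * Q p (ι j) + Σ[ K ] (λ i → u i * Q (ι i) (ι j)) ≈⟨ +-comm _ _ ⟩
        Σ[ K ] (λ i → u i * Q (ι i) (ι j)) + wₚ * Q p (ι j) ≈⟨ Σ-censored j ⟨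
        Σ[ K ] (λ i → u i * censored i j)                   ≈⟨ u-invariant j ⟩
        u j                                                 ≡⟨ insertAt-punchIn u p wₚ j ⟨
        uncensor u (ι j)                                    ∎

    module Uncensored (u : Fin K → Carrier) (u-stationary : IsStationary K censored u) where
      private
        0≤u   = proj₁ (proj₁ u-stationary)
        Σu≈1 = proj₂ (proj₁ u-stationary)

      mass : Carrier
      mass = t * returnMass u + 1#

      mass≉0 : ¬ mass ≈ 0#
      mass≉0 = x+1≉0 (*-nonneg 0≤t (Σ-nonneg K (λ i → *-nonneg (0≤u i) (Q-nonneg _ _))))

      Σ-uncensor : Σ[ suc K ] (uncensor u) ≈ mass
      Σ-uncensor = begin
        Σ[ suc K ] (uncensor u)                     ≈⟨ Σ-cong (suc K) (λ y → *-identityʳ (uncensor u y)) ⟨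
        Σ[ suc K ] (λ y → uncensor u y * 1#)        ≈⟨ Σ-insertAt-* K u p _ (λ _ → 1#) ⟩
        t * returnMass u * 1# + Σ[ K ] (λ j → u j * 1#)
          ≈⟨ +-cong (*-identityʳ _) (trans (Σ-cong K (λ j → *-identityʳ (u j))) Σu≈1) ⟩
        mass                                        ∎

      stationary : Fin (suc K) → Carrier
      stationary x = uncensor u x * inv mass mass≉0

      stationary-isStationary : IsStationary (suc K) Q stationary
      stationary-isStationary =
        normalised-stationary {Q = Q} (uncensor-nonneg u 0≤u) (uncensor-invariant u (proj₂ u-stationary))
                              Σ-uncensor mass≉0

    censored-atMostOne : AtMostOneStationary (suc K) Q → AtMostOneStationary K censored
    censored-atMostOne unique u v u-stationary v-stationary =
      proportional-distributions-equal (proj₂ (proj₁ u-stationary)) (proj₂ (proj₁ v-stationary))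
        (inverse-nonzero (inv-inverse U.mass U.mass≉0)) proportional
      where
      module U = Uncensored u u-stationary
      module V = Uncensored v v-stationary
      proportional : ∀ j → u j * inv U.mass U.mass≉0 ≈ v j * inv V.mass V.mass≉0
      proportional j = begin
        u j * inv U.mass U.mass≉0   ≡⟨ ≡.cong (_* _) (insertAt-punchIn u p _ j) ⟨
        U.stationary (ι j)          ≈⟨ unique U.stationary V.stationary U.stationary-isStationary V.stationary-isStationary (ι j) ⟩
        V.stationary (ι j)          ≡⟨ ≡.cong (_* _) (insertAt-punchIn v p _ j) ⟩
        v j * inv V.mass V.mass≉0   ∎

  -- If the state that is least likely to stay put never leaves, then no state ever leaves,
  -- and every point mass is stationary.
  minimal-exit-nonzero : ∀ {K} {Q : Fin (suc (suc K)) → Fin (suc (suc K)) → Carrier} →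
                         IsStochastic (suc (suc K)) Q → AtMostOneStationary (suc (suc K)) Q →
                         ∀ p → (∀ x → Q p p ≤ Q x x) → ¬ exitProb Q p ≈ 0#
  minimal-exit-nonzero {K} {Q} Q-stochastic@(Q-nonneg , Q-rows) unique p minimal exit≈0 =
    0≉1 (sym (unique (pointMass zero) (pointMass (suc zero)) (absorbing zero) (absorbing (suc zero)) zero))
    where
    Qpp≈1 : Q p p ≈ 1#
    Qpp≈1 = begin
      Q p p                  ≈⟨ +-identityʳ (Q p p) ⟨
      Q p p + 0#             ≈⟨ +-congˡ exit≈0 ⟨
      Q p p + exitProb Q p   ≈⟨ stay+exit≈1 Q-stochastic p ⟩
      1#                     ∎
    diagonal≈1 : ∀ x → Q x x ≈ 1#
    diagonal≈1 x = antisym (≤-respʳ-≈ (Q-rows x) (term≤Σ (suc K) (Q-nonneg x) x))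
                           (≤-respˡ-≈ Qpp≈1 (minimal x))
    absorbing : ∀ x → IsStationary (suc (suc K)) Q (pointMass x)
    absorbing x = pointMass-stationary Q x (row-pointMass Q-stochastic x (diagonal≈1 x))

  stationary-exists : ∀ K (Q : Fin (suc K) → Fin (suc K) → Carrier) → IsStochastic (suc K) Q →
                      AtMostOneStationary (suc K) Q → ∃ (IsStationary (suc K) Q)
  stationary-exists zero Q Q-stochastic _ =
    pointMass zero , pointMass-stationary Q zero (row-pointMass Q-stochastic zero Q00≈1)
    where
    Q00≈1 : Q zero zero ≈ 1#
    Q00≈1 = trans (sym (+-identityʳ _)) (proj₂ Q-stochastic zero)
  stationary-exists (suc K) Q Q-stochastic unique =
    Uncensored.stationary π π-stationary , Uncensored.stationary-isStationary π π-stationary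
    where
    p = proj₁ (diagonal-minimum Q)
    exit≉0 : ¬ exitProb Q p ≈ 0#
    exit≉0 = minimal-exit-nonzero Q-stochastic unique p (proj₂ (diagonal-minimum Q))
    open Censoring Q Q-stochastic p (inv (exitProb Q p) exit≉0) (inv-inverse _ exit≉0)
    censored-has-stationary : ∃ (IsStationary (suc K) censored)
    censored-has-stationary = stationary-exists K censored censored-stochastic (censored-atMostOne unique)
    π = proj₁ censored-has-stationary
    π-stationary = proj₂ censored-has-stationary

module Lumping {c ℓ₁ ℓ₂} (F : OrderedField c ℓ₁ ℓ₂) {n m}
               (P : Fin n → Fin n → OrderedField.Carrier F) (block : Fin n → Fin m)
               (α : Fin m → Fin n → OrderedField.Carrier F)
               (P-stochastic : Chain.IsStochastic F n P) (adapted : Chain.IsAdapted F block α)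
               (cond1 : Chain.Cond1′ F P block α adapted) where
  open OrderedField F hiding (zero)
  open Chain F
  open OrderedFieldProperties F
  open Sums F
  open Stationarity F
  open SetoidReasoning setoid

  private
    P-nonneg    = proj₁ P-stochastic
    P-rows      = proj₂ P-stochastic
    α-nonneg    = λ i → proj₁ (proj₁ adapted i)
    α-total     = λ i → proj₂ (proj₁ adapted i)
    α-vanishes  = proj₁ (proj₂ adapted)
    α-positive  = proj₂ (proj₂ adapted)

  αP : Fin m → Fin n → Carrier
  αP i s = Σ-over block i (λ s' → α i s' * P s' s)

  lumped : Fin m → Fin m → Carrier
  lumped i j = Σ-over block j (αP i)

  lift : (Fin m → Carrier) → Fin n → Carrier
  lift u s = u (block s) * α (block s) s

  Σ-over-multiple-of-α : ∀ j {f} k → (∀ s → block s ≡ j → f s ≈ k * α j s) → Σ-over block j f ≈ k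
  Σ-over-multiple-of-α j {f} k f≈kα = begin
    Σ-over block j f                   ≈⟨ Σ-over-cong block j f≈kα ⟩
    Σ-over block j (λ s → k * α j s)   ≈⟨ *-distribˡ-Σ-over block j k (α j) ⟨
    k * Σ-over block j (α j)           ≈⟨ *-congˡ (Σ-over-supported block j (α-vanishes j)) ⟩
    k * Σ[ n ] (α j)                   ≈⟨ *-congˡ (α-total j) ⟩
    k * 1#                             ≈⟨ *-identityʳ k ⟩
    k                                  ∎

  Σ-over-lift : ∀ u j → Σ-over block j (lift u) ≈ u j
  Σ-over-lift u j = Σ-over-multiple-of-α j (u j) (λ s bs≡j → reflexive (≡.cong (λ i → u i * α i s) bs≡j))

  -- Cond1 says exactly that α_i P is a combination of the α_j, i.e. α_i P = Σ_j lumped i j α_j.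
  lumpable : ∀ i s → αP i s ≈ lumped i (block s) * α (block s) s
  lumpable i s = begin
    αP i s                            ≈⟨ on-block s ≡.refl ⟩
    δᵢₛ * α (block s) s                ≈⟨ *-congʳ (Σ-over-multiple-of-α (block s) δᵢₛ on-block) ⟨
    lumped i (block s) * α (block s) s ∎
    where
    pos : ∀ s → 0# < α (block s) s
    pos s = α-positive (block s) s ≡.refl
    δᵢₛ = δ P block α pos i s
    on-block : ∀ s' → block s' ≡ block s → αP i s' ≈ δᵢₛ * α (block s) s'
    on-block s' bs'≡bs = begin
      αP i s'                                 ≈⟨ div-*-inverse (αP i s') _ (pos s') ⟨
      δ P block α pos i s' * α (block s') s'  ≈⟨ *-cong (cond1 i s' s bs'≡bs) (reflexive (≡.cong (λ j → α j s') bs'≡bs)) ⟩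
      δᵢₛ * α (block s) s'                     ∎

  lumped-stochastic : IsStochastic m lumped
  lumped-stochastic = lumped-nonneg , lumped-rows
    where
    lumped-nonneg : ∀ i j → 0# ≤ lumped i j
    lumped-nonneg i j = Σ-over-nonneg block j (λ s →
      Σ-over-nonneg block i (λ s' → *-nonneg (α-nonneg i s') (P-nonneg s' s)))
    lumped-rows : ∀ i → Σ[ m ] (lumped i) ≈ 1#
    lumped-rows i = begin
      Σ[ m ] (lumped i)                                         ≈⟨ Σ-partition block (αP i) ⟨
      Σ[ n ] (αP i)                                             ≈⟨ Σ-Σ-over-comm block i (λ s' s → α i s' * P s' s) ⟩
      Σ-over block i (λ s' → Σ[ n ] (λ s → α i s' * P s' s))    ≈⟨ Σ-over-multiple-of-α i 1# row ⟩
      1#                                                        ∎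
      where
      row : ∀ s' → block s' ≡ i → Σ[ n ] (λ s → α i s' * P s' s) ≈ 1# * α i s'
      row s' _ = begin
        Σ[ n ] (λ s → α i s' * P s' s)  ≈⟨ *-distribˡ-Σ n (α i s') (P s') ⟨
        α i s' * Σ[ n ] (P s')          ≈⟨ *-congˡ (P-rows s') ⟩
        α i s' * 1#                     ≈⟨ *-comm (α i s') 1# ⟩
        1# * α i s'                     ∎

  lift-stationary : ∀ u → IsStationary m lumped u → IsStationary n P (lift u)
  lift-stationary u ((0≤u , Σu≈1) , u-invariant) = (lift-nonneg , lift-total) , lift-invariant
    where
    lift-nonneg : ∀ s → 0# ≤ lift u s
    lift-nonneg s = *-nonneg (0≤u (block s)) (α-nonneg (block s) s)
    lift-total : Σ[ n ] (lift u) ≈ 1#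
    lift-total = trans (Σ-partition block (lift u)) (trans (Σ-cong m (Σ-over-lift u)) Σu≈1)
    lift-invariant : ∀ s → Σ[ n ] (λ s' → lift u s' * P s' s) ≈ lift u s
    lift-invariant s = begin
      Σ[ n ] (λ s' → lift u s' * P s' s)
        ≈⟨ Σ-partition block _ ⟩
      Σ[ m ] (λ j → Σ-over block j (λ s' → lift u s' * P s' s))
        ≈⟨ Σ-cong m (λ j → Σ-over-cong block j (λ s' bs'≡j → reflexive (≡.cong (λ k → u k * α k s' * P s' s) bs'≡j))) ⟩
      Σ[ m ] (λ j → Σ-over block j (λ s' → u j * α j s' * P s' s))
        ≈⟨ Σ-cong m (λ j → trans (Σ-over-cong block j (λ s' _ → *-assoc (u j) _ _)) (sym (*-distribˡ-Σ-over block j (u j) _))) ⟩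
      Σ[ m ] (λ j → u j * αP j s)
        ≈⟨ Σ-cong m (λ j → trans (*-congˡ (lumpable j s)) (sym (*-assoc (u j) _ _))) ⟩
      Σ[ m ] (λ j → u j * lumped j (block s) * α (block s) s)
        ≈⟨ *-distribʳ-Σ m _ _ ⟨
      Σ[ m ] (λ j → u j * lumped j (block s)) * α (block s) s
        ≈⟨ *-congʳ (u-invariant (block s)) ⟩
      lift u s
        ∎

  lumped-atMostOne : ∀ (μ : Fin n → Carrier) → (∀ ν → IsStationary n P ν → ∀ s → ν s ≈ μ s) → AtMostOneStationary m lumped
  lumped-atMostOne μ μ-unique u v u-stationary v-stationary j = begin
    u j                         ≈⟨ Σ-over-lift u j ⟨
    Σ-over block j (lift u)     ≈⟨ Σ-over-cong block j (λ s _ → trans (μ-unique _ (lift-stationary u u-stationary) s)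
                                                                       (sym (μ-unique _ (lift-stationary v v-stationary) s))) ⟩
    Σ-over block j (lift v)     ≈⟨ Σ-over-lift v j ⟩
    v j                         ∎

  lift-respects : ∀ u ν → (∀ s → ν s ≈ lift u s) → Respects block α ν
  lift-respects u ν ν≈lift i 0<νᵢ s bs≡i = div-unique 0<νᵢ (begin
    ν s                               ≈⟨ ν≈lift s ⟩
    lift u s                          ≡⟨ ≡.cong (λ j → u j * α j s) bs≡i ⟩
    u i * α i s                       ≈⟨ *-congʳ νᵢ≈uᵢ ⟨
    Σ-over block i ν * α i s          ∎)
    where
    νᵢ≈uᵢ : Σ-over block i ν ≈ u i
    νᵢ≈uᵢ = trans (Σ-over-cong block i (λ s _ → ν≈lift s)) (Σ-over-lift u i)

theorem5 : ∀ {c ℓ₁ ℓ₂} (F : OrderedField c ℓ₁ ℓ₂) (n m : ℕ)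
    (P : Fin n → Fin n → OrderedField.Carrier F) (μ : Fin n → OrderedField.Carrier F)
    (block : Fin n → Fin m) (α : Fin m → Fin n → OrderedField.Carrier F) →
    Chain.IsStochastic F n P →
    Chain.IsUniqueStationary F n P μ →
    Chain.BlocksNonempty F block →
    (adapted : Chain.IsAdapted F block α) →
    Chain.Cond1′ F P block α adapted →
    Σ (Fin n → OrderedField.Carrier F)
      (λ ν → Chain.IsDistribution F n ν × Chain.Respects F block α ν) →
    Chain.Respects F block α μ
theorem5 F n zero    P μ block α _ _ _ _ _ _ = λ ()
theorem5 F n (suc k) P μ block α P-stochastic (_ , μ-unique) _ adapted cond1 _ =
  lift-respects π μ (λ s → OrderedField.sym F (μ-unique (lift π) (lift-stationary π π-stationary) s))
  where
  open Lumping F P block α P-stochastic adapted cond1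
  lumped-has-stationary : ∃ (Chain.IsStationary F (suc k) lumped)
  lumped-has-stationary =
    Stationarity.stationary-exists F k lumped lumped-stochastic (lumped-atMostOne μ μ-unique)
  π = proj₁ lumped-has-stationary
  π-stationary = proj₂ lumped-has-stationary
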